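{- Let $m \geq 2$, let $t=(t_0,\dotsc,t_{m-1})$ be Boolean inputs with arrival times $a(t_0),\dotsc,a(t_{m-1}) \in \mathbb{N}$, and let $\Gamma=(\circ_0,\dotsc,\circ_{m-2})$ with each $\circ_i\in\{\textsc{And},\textsc{Or}\}$. Let $(t_0,\dotsc,t_{m-1}) = P_0 \mathbin{+\!\!+} \dotsb \mathbin{+\!\!+} P_c$ be the segment partition of $h(t;\Gamma)$. Then every circuit $C$ over $\{\textsc{And}2,\textsc{Or}2\}$ realizing $h(t;\Gamma)$ satisfies \[\operatorname{delay}(C) \ge \max\Big\{ \max_{t_i \in P_0} a(t_i) + 1,\ \max_{t_i \in P_b,\ b>0} a(t_i) + 2 \Big\}.\]
   Context: The generalized And-Or path is $h(t;\Gamma) := t_0 \circ_0 (t_1 \circ_1 ( \dotsb \circ_{m-3} (t_{m-2} \circ_{m-2} t_{m-1})))$. For $i\le m-2$, $\circ_i$ is the gate type of $t_i$. For $\circ\in\{\textsc{And},\textsc{Or}\}$, the same-gate input set $S^{\circ}$ is the set of all $t_i$ ($i\le m-2$) with $\circ_i=\circ$, together with $t_{m-1}$. The segment partition of $h(t;\Gamma)$ is the unique partition of the tuple $(t_0,\dotsc,t_{m-1})$ into maximal consecutive sub-tuples $P_0,\dotsc,P_c$ (concatenated in order, $\mathbin{+\!\!+}$ denoting concatenation) such that each $P_b$ is contained in $S^{\textsc{And}}$ or in $S^{\textsc{Or}}$. A circuit over $\{\textsc{And}2,\textsc{Or}2\}$ is a connected acyclic digraph whose vertices are inputs (no incoming edges;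 Boolean variables or constants) and gates (exactly two incoming edges, each computing binary And or Or), with a single output here; it realizes the function computed at its output. Given arrival times $a(t_i)$, $\operatorname{delay}(C) := \max_i \{ a(t_i) + \max_P |P| \}$, where $P$ ranges over directed paths in $C$ starting at $t_i$ and $|P|$ is its number of edges. A maximum over an empty set is ignored (treated as $-\infty$). -}

module Defs where

open import Data.Bool using (Bool; true; false; _∧_; _∨_)
open import Data.Nat using (ℕ; zero; suc; _+_; _≤_; _<_; _⊔_; pred)
open import Data.Fin using (Fin; zero; suc; toℕ; fromℕ<)
open import Data.Fin.Properties using (_≟_)
open import Data.List using (List; []; _∷_; _++_; concat; allFin; foldr; map; last)
open import Data.List.Relation.Unary.All using (All)
open import Data.Maybe using (Maybe; just; nothing)
open import Data.Product using (Σ; _×_; _,_)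
open import Data.Sum using (_⊎_)
open import Data.Unit using (⊤)
open import Relation.Nullary using (¬_; yes; no)
open import Relation.Binary.PropositionalEquality using (_≡_)

data GateType : Set where
  And Or : GateType

apply : GateType → Bool → Bool → Bool
apply And x y = x ∧ y
apply Or  x y = x ∨ y

-- Generalized And-Or path h(t;Γ) with inputs t_0..t_{m-1} (variables
-- indexed by Fin m) and Γ = (∘_0,…,∘_{m-2}) : Fin (pred m) → GateType.
-- h(t;Γ) = t_0 ∘_0 (t_1 ∘_1 ( … (t_{m-2} ∘_{m-2} t_{m-1})))

hSuc : (n : ℕ) → (Fin n → GateType) → (Fin (suc n) → Bool) → Bool
hSuc zero    Γ σ = σ zero
hSuc (suc n) Γ σ = apply (Γ zero) (σ zero) (hSuc n (λ j → Γ (suc j)) (λ j → σ (suc j)))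

h : (m : ℕ) → (Fin (pred m) → GateType) → (Fin m → Bool) → Bool
h zero    Γ σ = false   -- not used (m ≥ 2 in the theorem)
h (suc n) Γ σ = hSuc n Γ σ

InS : (m : ℕ) → (Fin (pred m) → GateType) → GateType → Fin m → Set
InS m Γ o i = (toℕ i ≡ pred m) ⊎ Σ (toℕ i < pred m) (λ p → Γ (fromℕ< p) ≡ o)

-- Segment partition: partition of the tuple (t_0,…,t_{m-1}) into
-- nonempty consecutive sub-tuples P_0 ++ … ++ P_c, each contained in
-- S^And or in S^Or, and maximal (no block can be extended by the
-- adjacent element of a neighbouring block while staying inside S^And
-- or inside S^Or).

lastL : {A : Set} → List A → List A
lastL xs with last xs
... | just x  = x ∷ []
... | nothing = []

firstL : {A : Set} → List A → List A
firstL []      = []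
firstL (x ∷ _) = x ∷ []

MaximalPair : (m : ℕ) → (Fin (pred m) → GateType) → List (Fin m) → List (Fin m) → Set
MaximalPair m Γ P Q =
  (o : GateType) → ¬ All (InS m Γ o) (P ++ firstL Q) × ¬ All (InS m Γ o) (lastL P ++ Q)

AdjacentMaximal : (m : ℕ) → (Fin (pred m) → GateType) → List (List (Fin m)) → Set
AdjacentMaximal m Γ (P ∷ Q ∷ Ps) = MaximalPair m Γ P Q × AdjacentMaximal m Γ (Q ∷ Ps)
AdjacentMaximal m Γ _            = ⊤

record IsSegmentPartition (m : ℕ) (Γ : Fin (pred m) → GateType)
                          (Ps : List (List (Fin m))) : Set where
  field
    covers   : concat Ps ≡ allFin m
    nonempty : All (λ P → ¬ P ≡ []) Ps
    sameGate : All (λ P → All (InS m Γ And) P ⊎ All (InS m Γ Or) P) Ps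
    maximal  : AdjacentMaximal m Γ Ps

-- Circuits over {And2, Or2}: a DAG given in topological order.
-- Circuit m k has k gates; a Node m k refers to an input vertex
-- (variable t_i or a Boolean constant) or to one of the k gates
-- (gate zero = most recently added gate).  Each gate has a type and two
-- incoming edges from earlier vertices, so sharing (fan-out) is allowed.

data Node (m k : ℕ) : Set where
  var   : Fin m → Node m k
  const : Bool → Node m k
  gate  : Fin k → Node m k

data Circuit (m : ℕ) : ℕ → Set where
  []  : Circuit m zero
  _▷_ : {k : ℕ} → Circuit m k → GateType × Node m k × Node m k → Circuit m (suc k)

eval : {m k : ℕ} → Circuit m k → (Fin m → Bool) → Node m k → Bool
eval C σ (var i)   = σ i
eval C σ (const b) = b
eval (C ▷ (o , x , y)) σ (gate zero)    = apply o (eval C σ x) (eval C σ y)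
eval (C ▷ _)           σ (gate (suc j)) = eval C σ (gate j)

Realizes : {m k : ℕ} → Circuit m k → Node m k → ((Fin m → Bool) → Bool) → Set
Realizes C out f = (σ : _) → eval C σ out ≡ f σ

-- Maybe ℕ with nothing = -∞

maxM : Maybe ℕ → Maybe ℕ → Maybe ℕ
maxM nothing  y        = y
maxM (just x) nothing  = just x
maxM (just x) (just y) = just (x ⊔ y)

data _≤ᴹ_ : Maybe ℕ → Maybe ℕ → Set where
  -∞≤   : {y : Maybe ℕ} → nothing ≤ᴹ y
  just≤ : {x y : ℕ} → x ≤ y → just x ≤ᴹ just y

mapM : (ℕ → ℕ) → Maybe ℕ → Maybe ℕ
mapM f nothing  = nothing
mapM f (just x) = just (f x)

maxOver : {A : Set} → List A → (A → ℕ) → Maybe ℕ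
maxOver xs f = foldr (λ x acc → maxM (just (f x)) acc) nothing xs

-- longest directed path (number of edges) from the input vertex t_i to a
-- given vertex; nothing if there is no such path
longest : {m k : ℕ} → Circuit m k → Fin m → Node m k → Maybe ℕ
longest C i (var j) with i ≟ j
... | yes _ = just 0
... | no  _ = nothing
longest C i (const b) = nothing
longest (C ▷ (o , x , y)) i (gate zero)    = mapM suc (maxM (longest C i x) (longest C i y))
longest (C ▷ _)           i (gate (suc j)) = longest C i (gate j)

delay : {m k : ℕ} → Circuit m k → Node m k → (Fin m → ℕ) → Maybe ℕ
delay {m} C out a =
  foldr (λ i acc → maxM (mapM (a i +_) (longest C i out)) acc) nothing (allFin m)

-- Every input t_i is reached by a path to the output, since h(t;Γ) depends on t_i.
-- A path of length 0 would make the output equal to t_i, so t_i would absorb both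
-- And and Or; a path of length 1 ends in a gate ∘ fed directly by t_i, so the
-- absorbing value of ∘ at t_i forces the output.  For the path h, an input t_i whose
-- absorbing value for ∘ forces the output puts all of t_0, …, t_i into S^∘.  Hence
-- t_0 ∈ S^And ∩ S^Or = {t_{m-1}} in the first case, and in the second case P_0
-- together with the first element of P_1 lies in S^∘, contradicting maximality.
module Submission where

open import Defs
open import Data.Nat using (ℕ; _≤_; _+_; pred)
open import Data.Fin using (Fin)
open import Data.List using (List; _∷_; concat)

open import Data.Bool using (Bool; true; false)
open import Data.Bool.Properties using (∧-comm; ∨-comm; ∧-idem; ∨-idem)
open import Data.Nat using (zero; suc; z≤n; s≤s)
open import Data.Nat.Properties
  using (≤-refl; ≤-trans; <⇒≤; m≤m⊔n; m≤n⊔m; ⊔-lub; +-monoʳ-≤; ≤-irrelevant; 0≢1+n)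
open import Data.Fin as Fin using (zero; suc; toℕ)
open import Data.Fin.Properties using (_≟_)
open import Data.List using ([]; _++_; foldr; allFin)
open import Data.List.Membership.Propositional using (_∈_)
open import Data.List.Membership.Propositional.Properties using (∈-allFin; ∈-++⁻; ∈-++⁺ʳ)
open import Data.List.Relation.Unary.Any using (here; there)
open import Data.List.Relation.Unary.All as All using (All)
open import Data.List.Relation.Unary.AllPairs using (AllPairs; _∷_)
open import Data.List.Relation.Unary.AllPairs.Properties using (tabulate⁺-<)
open import Data.Maybe using (Maybe; just; nothing)
open import Data.Product using (Σ; ∃; ∃₂; _×_; _,_; proj₁; proj₂)
open import Data.Sum using (_⊎_; inj₁; inj₂)
open import Data.Vec.Functional using () renaming (_∷_ to _∷ᵛ_)
open import Data.Empty using (⊥-elim)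
open import Function using (_∘_)
open import Relation.Nullary using (¬_; yes; no)
open import Relation.Binary.PropositionalEquality
  using (_≡_; _≢_; refl; sym; trans; cong; cong₂; subst)

≤ᴹ-trans : ∀ {x y z} → x ≤ᴹ y → y ≤ᴹ z → x ≤ᴹ z
≤ᴹ-trans -∞≤       _         = -∞≤
≤ᴹ-trans (just≤ p) (just≤ q) = just≤ (≤-trans p q)

maxM-upperˡ : ∀ x y → x ≤ᴹ maxM x y
maxM-upperˡ nothing  y        = -∞≤
maxM-upperˡ (just x) nothing  = just≤ ≤-refl
maxM-upperˡ (just x) (just y) = just≤ (m≤m⊔n x y)

maxM-upperʳ : ∀ x y → y ≤ᴹ maxM x y
maxM-upperʳ x        nothing  = -∞≤
maxM-upperʳ nothing  (just y) = just≤ ≤-refl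
maxM-upperʳ (just x) (just y) = just≤ (m≤n⊔m x y)

maxM-lub : ∀ {x y z} → x ≤ᴹ z → y ≤ᴹ z → maxM x y ≤ᴹ z
maxM-lub {nothing}           p         q         = q
maxM-lub {just x} {nothing}  p         q         = p
maxM-lub {just x} {just y}   (just≤ p) (just≤ q) = just≤ (⊔-lub p q)

maxOver-lub : ∀ {A : Set} (xs : List A) (f : A → ℕ) {z} →
              (∀ {x} → x ∈ xs → just (f x) ≤ᴹ z) → maxOver xs f ≤ᴹ z
maxOver-lub []       f bound = -∞≤
maxOver-lub (x ∷ xs) f bound = maxM-lub (bound (here refl)) (maxOver-lub xs f (bound ∘ there))

foldr-maxM-upper : ∀ {A : Set} (F : A → Maybe ℕ) {xs x} → x ∈ xs →
                   F x ≤ᴹ foldr (λ y acc → maxM (F y) acc) nothing xs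
foldr-maxM-upper F {y ∷ _} (here refl) = maxM-upperˡ (F y) _
foldr-maxM-upper F {y ∷ _} (there x∈)  = ≤ᴹ-trans (foldr-maxM-upper F x∈) (maxM-upperʳ (F y) _)

mapM-+-mono : ∀ a {c x} → just c ≤ᴹ x → just (a + c) ≤ᴹ mapM (a +_) x
mapM-+-mono a (just≤ c≤x) = just≤ (+-monoʳ-≤ a c≤x)

maxM≡nothing : ∀ x y → maxM x y ≡ nothing → x ≡ nothing × y ≡ nothing
maxM≡nothing nothing  nothing  _  = refl , refl
maxM≡nothing nothing  (just _) ()
maxM≡nothing (just _) nothing  ()
maxM≡nothing (just _) (just _) ()

maxM≡just0 : ∀ x y → maxM x y ≡ just 0 → x ≡ just 0 ⊎ y ≡ just 0
maxM≡just0 nothing        y              eq = inj₂ eq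
maxM≡just0 (just x)       nothing        eq = inj₁ eq
maxM≡just0 (just zero)    (just y)       _  = inj₁ refl
maxM≡just0 (just (suc x)) (just zero)    ()
maxM≡just0 (just (suc x)) (just (suc y)) ()

mapM-suc≡nothing : ∀ x → mapM suc x ≡ nothing → x ≡ nothing
mapM-suc≡nothing nothing _ = refl

mapM-suc≢just0 : ∀ x → mapM suc x ≢ just 0
mapM-suc≢just0 nothing  ()
mapM-suc≢just0 (just _) ()

mapM-suc≡just1 : ∀ x → mapM suc x ≡ just 1 → x ≡ just 0
mapM-suc≡just1 (just zero) _ = refl

absorbing : GateType → Bool
absorbing And = false
absorbing Or  = true

neutral : GateType → Bool
neutral And = true
neutral Or  = false

apply-comm : ∀ o x y → apply o x y ≡ apply o y x
apply-comm And = ∧-comm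
apply-comm Or  = ∨-comm

apply-idem : ∀ o x → apply o x x ≡ x
apply-idem And = ∧-idem
apply-idem Or  = ∨-idem

apply-absorbingˡ : ∀ o x → apply o (absorbing o) x ≡ absorbing o
apply-absorbingˡ And x = refl
apply-absorbingˡ Or  x = refl

apply-absorbingʳ : ∀ o x → apply o x (absorbing o) ≡ absorbing o
apply-absorbingʳ o x = trans (apply-comm o x (absorbing o)) (apply-absorbingˡ o x)

apply-neutralˡ : ∀ o x → apply o (neutral o) x ≡ x
apply-neutralˡ And x = refl
apply-neutralˡ Or  x = refl

apply-neutralʳ : ∀ o x → apply o x (neutral o) ≡ x
apply-neutralʳ o x = trans (apply-comm o x (neutral o)) (apply-neutralˡ o x)

apply-neutralˡ≡absorbing : ∀ g o x → apply g (neutral o) x ≡ absorbing o →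
                           g ≡ o × x ≡ absorbing o
apply-neutralˡ≡absorbing And And x eq = refl , eq
apply-neutralˡ≡absorbing Or  Or  x eq = refl , eq

Forces : {m : ℕ} → ((Fin m → Bool) → Bool) → Fin m → GateType → Set
Forces f i o = ∀ σ → σ i ≡ absorbing o → f σ ≡ absorbing o

DependsOn : {m : ℕ} → ((Fin m → Bool) → Bool) → Fin m → Set
DependsOn {m} f i = ∃₂ λ (σ σ′ : Fin m → Bool) → (∀ j → j ≢ i → σ j ≡ σ′ j) × f σ ≢ f σ′

Forces-resp : ∀ {m} {f g : (Fin m → Bool) → Bool} {i o} →
              (∀ σ → f σ ≡ g σ) → Forces f i o → Forces g i o
Forces-resp f≗g F σ σi = trans (sym (f≗g σ)) (F σ σi)

DependsOn-resp : ∀ {m} {f g : (Fin m → Bool) → Bool} {i} →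
                 (∀ σ → f σ ≡ g σ) → DependsOn f i → DependsOn g i
DependsOn-resp f≗g (σ , σ′ , agree , differ) =
  σ , σ′ , agree , λ eq → differ (trans (f≗g σ) (trans eq (sym (f≗g σ′))))

eval-independent : ∀ {m k} (C : Circuit m k) i n {σ σ′ : Fin m → Bool} →
                   longest C i n ≡ nothing → (∀ j → j ≢ i → σ j ≡ σ′ j) →
                   eval C σ n ≡ eval C σ′ n
eval-independent C i (var j) noPath agree with i ≟ j
... | no i≢j = agree j (i≢j ∘ sym)
eval-independent C i (var j) () agree | yes _
eval-independent C i (const b) noPath agree = refl
eval-independent (C ▷ (o , x , y)) i (gate zero) noPath agree
  with maxM≡nothing _ _ (mapM-suc≡nothing _ noPath)
... | noPathˣ , noPathʸ =
  cong₂ (apply o) (eval-independent C i x noPathˣ agree) (eval-independent C i y noPathʸ agree)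
eval-independent (C ▷ _) i (gate (suc j)) noPath agree =
  eval-independent C i (gate j) noPath agree

eval-longest≡0 : ∀ {m k} (C : Circuit m k) i n σ → longest C i n ≡ just 0 → eval C σ n ≡ σ i
eval-longest≡0 C i (var j) σ path with i ≟ j
... | yes refl = refl
eval-longest≡0 C i (var j) σ () | no _
eval-longest≡0 C i (const b) σ ()
eval-longest≡0 (C ▷ _) i (gate zero) σ path = ⊥-elim (mapM-suc≢just0 _ path)
eval-longest≡0 (C ▷ _) i (gate (suc j)) σ path = eval-longest≡0 C i (gate j) σ path

eval-longest≡1 : ∀ {m k} (C : Circuit m k) i n →
                 longest C i n ≡ just 1 → ∃ λ o → Forces (λ σ → eval C σ n) i o
eval-longest≡1 C i (var j) path with i ≟ j
eval-longest≡1 C i (var j) () | yes _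
eval-longest≡1 C i (var j) () | no _
eval-longest≡1 C i (const b) ()
eval-longest≡1 (C ▷ (o , x , y)) i (gate zero) path
  with maxM≡just0 _ _ (mapM-suc≡just1 _ path)
... | inj₁ pathˣ = o , λ σ σi →
  trans (cong (λ b → apply o b (eval C σ y)) (trans (eval-longest≡0 C i x σ pathˣ) σi))
        (apply-absorbingˡ o _)
... | inj₂ pathʸ = o , λ σ σi →
  trans (cong (apply o (eval C σ x)) (trans (eval-longest≡0 C i y σ pathʸ) σi))
        (apply-absorbingʳ o _)
eval-longest≡1 (C ▷ _) i (gate (suc j)) path = eval-longest≡1 C i (gate j) path

module _ {m k} (C : Circuit m k) (out : Node m k) {f : (Fin m → Bool) → Bool}
         (realizes : Realizes C out f) {i : Fin m} (dependent : DependsOn f i) where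

  longest≢nothing : longest C i out ≢ nothing
  longest≢nothing noPath with DependsOn-resp (sym ∘ realizes) dependent
  ... | σ , σ′ , agree , differ = differ (eval-independent C i out noPath agree)

  longest≡0⇒Forces : longest C i out ≡ just 0 → ∀ o → Forces f i o
  longest≡0⇒Forces path o = Forces-resp realizes (λ σ → trans (eval-longest≡0 C i out σ path))

  longest≥1 : ¬ (∀ o → Forces f i o) → just 1 ≤ᴹ longest C i out
  longest≥1 notAll with longest C i out in path
  ... | nothing      = ⊥-elim (longest≢nothing path)
  ... | just zero    = ⊥-elim (notAll (longest≡0⇒Forces path))
  ... | just (suc _) = just≤ (s≤s z≤n)

  longest≥2 : (∀ o → ¬ Forces f i o) → just 2 ≤ᴹ longest C i out
  longest≥2 none with longest C i out in path
  ... | nothing            = ⊥-elim (longest≢nothing path)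
  ... | just zero          = ⊥-elim (none And (longest≡0⇒Forces path And))
  ... | just (suc zero)    with eval-longest≡1 C i out path
  ...   | o , F            = ⊥-elim (none o (Forces-resp realizes F))
  longest≥2 none | just (suc (suc _)) = just≤ (s≤s (s≤s z≤n))

hSuc-const : ∀ N Γ b → hSuc N Γ (λ _ → b) ≡ b
hSuc-const zero    Γ b = refl
hSuc-const (suc N) Γ b = trans (cong (apply (Γ zero) b) (hSuc-const N (Γ ∘ suc) b)) (apply-idem (Γ zero) b)

-- Fixing the inputs before i to the neutral value of their gate and those after i to
-- the neutral value of the gate of t_i makes h equal to t_i.
hSuc-transmits : ∀ N Γ (i : Fin (suc N)) → Σ (Bool → Fin (suc N) → Bool) λ s →
                 (∀ b → hSuc N Γ (s b) ≡ b) × (∀ b b′ j → j ≢ i → s b j ≡ s b′ j)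
hSuc-transmits zero Γ zero = (λ b _ → b) , (λ b → refl) , agree
  where
  agree : ∀ b b′ (j : Fin 1) → j ≢ zero → b ≡ b′
  agree b b′ zero j≢0 = ⊥-elim (j≢0 refl)
hSuc-transmits (suc N) Γ zero = s , transmits , agree
  where
  s : Bool → Fin (suc (suc N)) → Bool
  s b = b ∷ᵛ λ _ → neutral (Γ zero)
  transmits : ∀ b → hSuc (suc N) Γ (s b) ≡ b
  transmits b = trans (cong (apply (Γ zero) b) (hSuc-const N (Γ ∘ suc) (neutral (Γ zero))))
                      (apply-neutralʳ (Γ zero) b)
  agree : ∀ b b′ j → j ≢ zero → s b j ≡ s b′ j
  agree b b′ zero    j≢0 = ⊥-elim (j≢0 refl)
  agree b b′ (suc j) _   = refl
hSuc-transmits (suc N) Γ (suc i) with hSuc-transmits N (Γ ∘ suc) i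
... | s′ , transmits′ , agree′ = s , transmits , agree
  where
  s : Bool → Fin (suc (suc N)) → Bool
  s b = neutral (Γ zero) ∷ᵛ s′ b
  transmits : ∀ b → hSuc (suc N) Γ (s b) ≡ b
  transmits b = trans (apply-neutralˡ (Γ zero) _) (transmits′ b)
  agree : ∀ b b′ j → j ≢ suc i → s b j ≡ s b′ j
  agree b b′ zero    _   = refl
  agree b b′ (suc j) j≢i = agree′ b b′ j (j≢i ∘ cong suc)

hSuc-dependsOn : ∀ N Γ i → DependsOn (hSuc N Γ) i
hSuc-dependsOn N Γ i with hSuc-transmits N Γ i
... | s , transmits , agree =
  s true , s false , agree true false ,
  λ eq → true≢false (trans (sym (transmits true)) (trans eq (transmits false)))
  where
  true≢false : true ≢ false
  true≢false ()

hSuc-Forces-zero : ∀ N Γ o → Forces (hSuc (suc N) Γ) zero o → Γ zero ≡ o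
hSuc-Forces-zero N Γ o F = proj₁ (apply-neutralˡ≡absorbing (Γ zero) o (absorbing o) absorbed)
  where
  absorbed : apply (Γ zero) (neutral o) (absorbing o) ≡ absorbing o
  absorbed = trans (apply-comm (Γ zero) (neutral o) (absorbing o))
                   (trans (cong (apply (Γ zero) (absorbing o)) (sym (hSuc-const N (Γ ∘ suc) (neutral o))))
                          (F (absorbing o ∷ᵛ λ _ → neutral o) refl))

hSuc-Forces-suc : ∀ N Γ o i → Forces (hSuc (suc N) Γ) (suc i) o →
                  Γ zero ≡ o × Forces (hSuc N (Γ ∘ suc)) i o
hSuc-Forces-suc N Γ o i F =
  proj₁ (peel (λ _ → absorbing o) refl) , λ σ σi → proj₂ (peel σ σi)
  where
  peel : ∀ σ → σ i ≡ absorbing o → Γ zero ≡ o × hSuc N (Γ ∘ suc) σ ≡ absorbing o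
  peel σ σi = apply-neutralˡ≡absorbing (Γ zero) o _ (F (neutral o ∷ᵛ σ) σi)

PrefixInS : (m : ℕ) → (Fin (pred m) → GateType) → GateType → Fin m → Set
PrefixInS m Γ o i = ∀ j → j Fin.≤ i → InS m Γ o j

hSuc-Forces⇒PrefixInS : ∀ N Γ o i → Forces (hSuc N Γ) i o → PrefixInS (suc N) Γ o i
hSuc-Forces⇒PrefixInS zero    Γ o zero    F zero _ = inj₁ refl
hSuc-Forces⇒PrefixInS (suc N) Γ o zero    F zero _ = inj₂ (s≤s z≤n , hSuc-Forces-zero N Γ o F)
hSuc-Forces⇒PrefixInS (suc N) Γ o (suc i) F j j≤i with hSuc-Forces-suc N Γ o i F
... | Γ₀≡o , F′ = prefix j j≤i
  where
  prefix : PrefixInS (suc (suc N)) Γ o (suc i)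
  prefix zero    _         = inj₂ (s≤s z≤n , Γ₀≡o)
  prefix (suc j) (s≤s j≤i) with hSuc-Forces⇒PrefixInS N (Γ ∘ suc) o i F′ j j≤i
  ... | inj₁ last        = inj₁ (cong suc last)
  ... | inj₂ (j< , Γj≡o) = inj₂ (s≤s j< , Γj≡o)

InS-And-Or⇒last : ∀ {m Γ} j → InS m Γ And j → InS m Γ Or j → toℕ j ≡ pred m
InS-And-Or⇒last j (inj₁ last) _           = last
InS-And-Or⇒last j (inj₂ _)    (inj₁ last) = last
InS-And-Or⇒last j (inj₂ (p , isAnd)) (inj₂ (q , isOr)) rewrite ≤-irrelevant p q
  with trans (sym isAnd) isOr
... | ()

hSuc-¬Forces-all : ∀ N Γ i → ¬ (∀ o → Forces (hSuc (suc N) Γ) i o)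
hSuc-¬Forces-all N Γ i F = 0≢1+n (InS-And-Or⇒last {suc (suc N)} {Γ} zero (prefix And) (prefix Or))
  where
  prefix : ∀ o → InS (suc (suc N)) Γ o zero
  prefix o = hSuc-Forces⇒PrefixInS (suc N) Γ o i (F o) zero z≤n

AllPairs-++⇒ : ∀ {A : Set} {R : A → A → Set} xs {ys x y} →
               AllPairs R (xs ++ ys) → x ∈ xs → y ∈ ys → R x y
AllPairs-++⇒ (x ∷ xs) (Rx ∷ _)  (here refl) y∈ = All.lookup Rx (∈-++⁺ʳ xs y∈)
AllPairs-++⇒ (_ ∷ xs) (_ ∷ Rxs) (there x∈)  y∈ = AllPairs-++⇒ xs Rxs x∈ y∈

AllPairs-++ʳ : ∀ {A : Set} {R : A → A → Set} xs {ys} → AllPairs R (xs ++ ys) → AllPairs R ys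
AllPairs-++ʳ []       Rys       = Rys
AllPairs-++ʳ (_ ∷ xs) (_ ∷ Rys) = AllPairs-++ʳ xs Rys

allFin-sorted : ∀ m → AllPairs Fin._<_ (allFin m)
allFin-sorted m = tabulate⁺-< (λ i<j → i<j)

sorted-head-≤ : ∀ {m} {q : Fin m} {qs i} → AllPairs Fin._<_ (q ∷ qs) → i ∈ q ∷ qs → q Fin.≤ i
sorted-head-≤ _          (here refl) = ≤-refl
sorted-head-≤ (q< ∷ _)   (there i∈)  = <⇒≤ (All.lookup q< i∈)

-- Maximality of P₀ forbids P₀ extended by the first element of the next segment to lie
-- in S^o, and that extension is a prefix of t_0, …, t_i.
segmentPartition-¬PrefixInS : ∀ {m Γ o P₀ Ps} → IsSegmentPartition m Γ (P₀ ∷ Ps) →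
                              ∀ {i} → i ∈ concat Ps → ¬ PrefixInS m Γ o i
segmentPartition-¬PrefixInS {Ps = []} SP () prefix
segmentPartition-¬PrefixInS {Ps = [] ∷ _} SP i∈ prefix =
  All.head (All.tail (IsSegmentPartition.nonempty SP)) refl
segmentPartition-¬PrefixInS {m} {Γ} {o} {P₀} {(q ∷ Q) ∷ Ps} SP {i} i∈ prefix =
  proj₁ (proj₁ (IsSegmentPartition.maximal SP) o) (All.tabulate extended)
  where
  sorted : AllPairs Fin._<_ (P₀ ++ q ∷ Q ++ concat Ps)
  sorted = subst (AllPairs Fin._<_) (sym (IsSegmentPartition.covers SP)) (allFin-sorted m)
  extended : ∀ {x} → x ∈ P₀ ++ q ∷ [] → InS m Γ o x
  extended {x} x∈ with ∈-++⁻ P₀ x∈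
  ... | inj₁ x∈P₀       = prefix x (<⇒≤ (AllPairs-++⇒ P₀ sorted x∈P₀ i∈))
  ... | inj₂ (here refl) = prefix q (sorted-head-≤ (AllPairs-++ʳ P₀ sorted) i∈)

mainTheorem3 : (m : ℕ) → 2 ≤ m →
    (a : Fin m → ℕ) (Γ : Fin (pred m) → GateType) →
    (P₀ : List (Fin m)) (Ps : List (List (Fin m))) →
    IsSegmentPartition m Γ (P₀ ∷ Ps) →
    (k : ℕ) (C : Circuit m k) (out : Node m k) →
    Realizes C out (h m Γ) →
    maxM (maxOver P₀ (λ i → a i + 1)) (maxOver (concat Ps) (λ i → a i + 2))
      ≤ᴹ delay C out a
mainTheorem3 (suc (suc n)) (s≤s (s≤s z≤n)) a Γ P₀ Ps SP k C out realizes =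
  maxM-lub (maxOver-lub P₀ _ λ {i} _ →
             bound i (longest≥1 C out realizes (dependent i) (hSuc-¬Forces-all n Γ i)))
           (maxOver-lub (concat Ps) _ λ {i} i∈ →
             bound i (longest≥2 C out realizes (dependent i) λ o F →
               segmentPartition-¬PrefixInS SP i∈ (hSuc-Forces⇒PrefixInS (suc n) Γ o i F)))
  where
  dependent : ∀ i → DependsOn (h (suc (suc n)) Γ) i
  dependent = hSuc-dependsOn (suc n) Γ
  bound : ∀ i {c} → just c ≤ᴹ longest C i out → just (a i + c) ≤ᴹ delay C out a
  bound i c≤ = ≤ᴹ-trans (mapM-+-mono (a i) c≤)
                        (foldr-maxM-upper (λ j → mapM (a j +_) (longest C j out)) (∈-allFin i))
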